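{- Let $S\subset\mathbb{F}_2^n$, let $F=F(S)=\{\mathbf{x}\in\mathbb{F}_2^n\mid\mathbf{x}+S=S\}$, $f=\dim F$, and $r=\dim\langle\mathbf{s}_0+S\rangle$ for some (equivalently, any) $\mathbf{s}_0\in S$. If $\#S$ is not a multiple of $2^{f+1}$, then $$B(S)=\mathbb{F}_2^n\setminus H\quad\text{and}\quad b(S)=2^{r-f}(2^f-1),$$ where $H=\bigcap_{\mathbf{s}\in F}H_{\mathbf{s}}$.
   Context: For $\mathbf{x},\mathbf{y}\in\mathbb{F}_2^n$ the pairing is $\mathbf{x}\cdot\mathbf{y}=\sum_{i=1}^n x_iy_i\in\mathbb{F}_2$, and $H_{\mathbf{y}}=\{\mathbf{x}\in\mathbb{F}_2^n\mid \mathbf{x}\cdot\mathbf{y}=0\}$ (so $H_{\mathbf{0}}=\mathbb{F}_2^n$). For a nonzero $\mathbf{y}$, a set $S$ is $\mathbf{y}$-balanced if $\#(S\cap H_{\mathbf{y}})=\#S/2$. $S$ is $\mathbf{y}$-constant if $S\subset H_{\mathbf{y}}$ or $S\cap H_{\mathbf{y}}=\emptyset$. The balancing set $B(S)$ is the set of nonzero $\mathbf{y}$ such that $S$ is $\mathbf{y}$-balanced; the constant set $C(S)$ is the set of $\mathbf{y}$ such that $S$ is $\mathbf{y}$-constant. The balancing number is $b(S)=\#B(S)/\#C(S)$. For $\mathbf{v}\in\mathbb{F}_2^n$, $\mathbf{v}+S=\{\mathbf{v}+\mathbf{x}\mid\mathbf{x}\in S\}$; $\langle\cdot\rangle$ denotes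 linear span. -}

module Defs where

open import Data.Bool using (Bool; true; false; _xor_; _∧_; _∨_; not; if_then_else_)
open import Data.Nat using (ℕ; zero; suc; _+_; _*_; _∸_; _^_)
open import Data.List as L using (List; []; _∷_; _++_; map; length)
open import Data.List.Relation.Unary.All using (All)
import Data.Nat.ListAction as NL
import Data.Bool.ListAction as BL
open import Data.Vec as V using (Vec; []; _∷_; zipWith; replicate)
open import Data.Product using (Σ; _×_; _,_)
open import Data.Integer using (+_)
open import Data.Rational using (ℚ; _/_; 0ℚ)
open import Relation.Binary.PropositionalEquality using (_≡_)
open import Function.Bundles using (_⇔_)

-- The vector space F₂ⁿ, with Bool as F₂ (xor = addition, ∧ = multiplication).
V₂ : ℕ → Set
V₂ n = Vec Bool n

_⊕_ : ∀ {n} → V₂ n → V₂ n → V₂ n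
_⊕_ = zipWith _xor_

𝟎 : ∀ {n} → V₂ n
𝟎 {n} = replicate n false

_·_ : ∀ {n} → V₂ n → V₂ n → Bool
x · y = V.foldr _ _xor_ false (zipWith _∧_ x y)

-- list of all elements of F₂ⁿ (each exactly once)
allV : (n : ℕ) → List (V₂ n)
allV zero = [] ∷ []
allV (suc n) = map (false ∷_) (allV n) ++ map (true ∷_) (allV n)

SubsetV : ℕ → Set
SubsetV n = V₂ n → Bool

# : ∀ {n} → SubsetV n → ℕ
# {n} P = NL.sum (map (λ x → if P x then 1 else 0) (allV n))

_∩_ : ∀ {n} → SubsetV n → SubsetV n → SubsetV n
(P ∩ Q) x = P x ∧ Q x

H[_] : ∀ {n} → V₂ n → SubsetV n
H[ y ] x = not (x · y)

allB : ∀ {n} → SubsetV n → Bool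
allB {n} P = BL.all P (allV n)

nonzero : ∀ {n} → V₂ n → Bool
nonzero y = BL.or (V.toList y)

balanced : ∀ {n} → SubsetV n → V₂ n → Bool
balanced S y = (2 * # (S ∩ H[ y ])) Data.Nat.≡ᵇ # S

yconstant : ∀ {n} → SubsetV n → V₂ n → Bool
yconstant S y = allB (λ x → not (S x) ∨ H[ y ] x) ∨ allB (λ x → not (S x ∧ H[ y ] x))

Bset : ∀ {n} → SubsetV n → SubsetV n
Bset S y = nonzero y ∧ balanced S y

Cset : ∀ {n} → SubsetV n → SubsetV n
Cset S y = yconstant S y

-- a / b in ℚ (b = 0 ↦ 0; irrelevant here since 0 ∈ C(S) always)
divℕ : ℕ → ℕ → ℚ
divℕ a zero = 0ℚ
divℕ a (suc d) = (+ a) / suc d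

bnum : ∀ {n} → SubsetV n → ℚ
bnum S = divℕ (# (Bset S)) (# (Cset S))

_+S_ : ∀ {n} → V₂ n → SubsetV n → SubsetV n
(v +S S) x = S (v ⊕ x)

InF : ∀ {n} → SubsetV n → V₂ n → Set
InF S x = ∀ z → (x +S S) z ≡ S z

InH : ∀ {n} → SubsetV n → V₂ n → Set
InH S y = ∀ s → InF S s → H[ y ] s ≡ true

vsum : ∀ {n} → List (V₂ n) → V₂ n
vsum = L.foldr _⊕_ 𝟎

lincomb : ∀ {n} (L : List (V₂ n)) → Vec Bool (length L) → V₂ n
lincomb [] [] = 𝟎
lincomb (v ∷ L) (c ∷ cs) = (if c then v else 𝟎) ⊕ lincomb L cs

InSpanList : ∀ {n} → List (V₂ n) → V₂ n → Set
InSpanList L y = Σ (Vec Bool (length L)) λ c → lincomb L c ≡ y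

LinIndep : ∀ {n} → List (V₂ n) → Set
LinIndep L = ∀ c → lincomb L c ≡ 𝟎 → c ≡ replicate (length L) false

InSpan : ∀ {n} → (V₂ n → Set) → V₂ n → Set
InSpan T y = Σ (List _) λ L → All T L × vsum L ≡ y

HasDim : ∀ {n} → (V₂ n → Set) → ℕ → Set
HasDim {n} W d = Σ (List (V₂ n)) λ L →
  length L ≡ d × LinIndep L × (∀ y → InSpanList L y ⇔ W y)

-- The periods F of S act on S by translation, so S and, for y ⊥ F, also S ∩ H_y are unions of
-- F-cosets, of size divisible by 2^f. Hence for y ∈ H = F^⊥ balance would force 2^(f+1) ∣ #S,
-- while for y ∉ H a period v with v · y = 1 swaps S ∩ H_y with S ∖ H_y, so S is y-balanced:
-- B(S) is the complement of F^⊥. On the other side, S is y-constant exactly when y is orthogonal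
-- to every difference s₀ + s, so C(S) = ⟨s₀ + S⟩^⊥. Row reduction along the first coordinate
-- gives #L^⊥ = 2^(n - #L) for independent L (and the coset divisibility), hence
-- #B(S) = 2^n - 2^(n-f) and #C(S) = 2^(n-r); since F ⊆ ⟨s₀ + S⟩ we have f ≤ r, and the quotient
-- is 2^(r-f) (2^f - 1).

module Submission where

open import Defs
open import Algebra.Bundles using (CommutativeSemigroup; CommutativeRing)
import Algebra.Properties.CommutativeSemigroup as CommSemigroupProperties
open import Data.Bool using (Bool; true; false; not; _xor_; _∧_; _∨_; if_then_else_)
open import Data.Bool.Properties
  using (xor-assoc; xor-comm; xor-identityˡ; xor-identityʳ; xor-same; xor-∧-commutativeRing
        ; ∧-distribʳ-xor; ∧-comm; ∧-conicalʳ; ∨-zeroʳ; ¬-not; not-injective; T-≡; T-not-≡; ⇔→≡)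
import Data.Bool.ListAction as BL
open import Data.Empty using (⊥-elim)
open import Data.Integer using (+_)
import Data.Integer.Properties as ℤ
open import Data.List using (List; []; _∷_; _++_; map; length)
open import Data.List.Properties using (map-++; map-∘; map-cong)
open import Data.List.Membership.Propositional using (_∈_)
open import Data.List.Membership.Propositional.Properties using (∈-map⁺; ∈-++⁺ˡ; ∈-++⁺ʳ)
open import Data.List.Relation.Unary.All as All using (All; []; _∷_)
open import Data.List.Relation.Unary.All.Properties using (all⁺; all⁻)
open import Data.List.Relation.Unary.Any using (here)
open import Data.Nat using (ℕ; zero; suc; _+_; _*_; _∸_; _^_; _≤_; z≤n; s≤s; NonZero)
open import Data.Nat.Divisibility using (_∣_; ∣m∣n⇒∣m+n; *-monoʳ-∣; 1∣_)
import Data.Nat.ListAction as NL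
open import Data.Nat.ListAction.Properties using (sum-++)
open import Data.Nat.Properties
  using (+-assoc; +-comm; +-identityʳ; +-commutativeSemigroup; *-assoc; *-comm; *-identityˡ
        ; *-distribʳ-∸; ^-distribˡ-+-*; m^n≢0; +-∸-assoc; m+n∸m≡n; m+[n∸m]≡n; m∸[m∸n]≡n
        ; ≤-refl; ≤-trans; +-mono-≤; m≤n⇒m≤1+n; ∸-monoʳ-≤; ^-monoʳ-<; ≮⇒≥; <⇒≱; ≡ᵇ⇒≡; ≡⇒≡ᵇ)
open import Data.Product using (Σ; _×_; _,_; proj₂)
open import Data.Rational using (_/_)
open import Data.Rational.Properties using (fromℚᵘ-cong)
open import Data.Rational.Unnormalised using (mkℚᵘ; *≡*)
open import Data.Unit using (⊤; tt)
open import Data.Vec as V using ([]; _∷_; zipWith)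
open import Data.Vec.Properties using (zipWith-assoc; zipWith-comm; zipWith-identityˡ; zipWith-identityʳ)
open import Function using (_∘_; case_of_)
open import Function.Bundles using (_⇔_; Equivalence; mk⇔)
open import Function.Properties.Equivalence using (⇔-setoid)
open import Level using (0ℓ)
open import Relation.Binary.PropositionalEquality
open import Relation.Binary.PropositionalEquality.Algebra using (isMagma)
import Relation.Binary.Reasoning.Setoid as SetoidReasoning
open import Relation.Nullary using (¬_)

-- Linear algebra over F₂

⊕-assoc : ∀ {n} (a b c : V₂ n) → (a ⊕ b) ⊕ c ≡ a ⊕ (b ⊕ c)
⊕-assoc = zipWith-assoc xor-assoc

⊕-comm : ∀ {n} (a b : V₂ n) → a ⊕ b ≡ b ⊕ a
⊕-comm = zipWith-comm xor-comm

⊕-identityˡ : ∀ {n} (a : V₂ n) → 𝟎 ⊕ a ≡ a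
⊕-identityˡ = zipWith-identityˡ xor-identityˡ

⊕-identityʳ : ∀ {n} (a : V₂ n) → a ⊕ 𝟎 ≡ a
⊕-identityʳ = zipWith-identityʳ xor-identityʳ

⊕-self : ∀ {n} (a : V₂ n) → a ⊕ a ≡ 𝟎
⊕-self []      = refl
⊕-self (x ∷ a) = cong₂ _∷_ (xor-same x) (⊕-self a)

⊕-cancelˡ : ∀ {n} (a b : V₂ n) → a ⊕ (a ⊕ b) ≡ b
⊕-cancelˡ a b = begin
  a ⊕ (a ⊕ b) ≡⟨ ⊕-assoc a a b ⟨
  (a ⊕ a) ⊕ b ≡⟨ cong (_⊕ b) (⊕-self a) ⟩
  𝟎 ⊕ b       ≡⟨ ⊕-identityˡ b ⟩
  b           ∎
  where open ≡-Reasoning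

⊕-cancelʳ : ∀ {n} (a b : V₂ n) → (a ⊕ b) ⊕ b ≡ a
⊕-cancelʳ a b = begin
  (a ⊕ b) ⊕ b ≡⟨ ⊕-assoc a b b ⟩
  a ⊕ (b ⊕ b) ≡⟨ cong (a ⊕_) (⊕-self b) ⟩
  a ⊕ 𝟎       ≡⟨ ⊕-identityʳ a ⟩
  a           ∎
  where open ≡-Reasoning

⊕-commutativeSemigroup : ℕ → CommutativeSemigroup 0ℓ 0ℓ
⊕-commutativeSemigroup n = record
  { Carrier = V₂ n
  ; _≈_ = _≡_
  ; _∙_ = _⊕_
  ; isCommutativeSemigroup = record
    { isSemigroup = record { isMagma = isMagma _⊕_ ; assoc = ⊕-assoc }
    ; comm = ⊕-comm
    }
  }

⊕-interchange : ∀ {n} (a b c d : V₂ n) → (a ⊕ b) ⊕ (c ⊕ d) ≡ (a ⊕ c) ⊕ (b ⊕ d)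
⊕-interchange {n} = CommSemigroupProperties.interchange (⊕-commutativeSemigroup n)

xor-interchange : ∀ a b c d → (a xor b) xor (c xor d) ≡ (a xor c) xor (b xor d)
xor-interchange = CommSemigroupProperties.interchange (CommutativeRing.+-commutativeSemigroup xor-∧-commutativeRing)

·-distribʳ-⊕ : ∀ {n} (u v y : V₂ n) → (u ⊕ v) · y ≡ (u · y) xor (v · y)
·-distribʳ-⊕ []      []      []      = refl
·-distribʳ-⊕ (a ∷ u) (b ∷ v) (c ∷ y) = begin
  ((a xor b) ∧ c) xor ((u ⊕ v) · y)
    ≡⟨ cong₂ _xor_ (∧-distribʳ-xor c a b) (·-distribʳ-⊕ u v y) ⟩
  ((a ∧ c) xor (b ∧ c)) xor (u · y xor v · y)
    ≡⟨ xor-interchange (a ∧ c) (b ∧ c) (u · y) (v · y) ⟩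
  ((a ∧ c) xor u · y) xor ((b ∧ c) xor v · y) ∎
  where open ≡-Reasoning

𝟎·y≡false : ∀ {n} (y : V₂ n) → 𝟎 · y ≡ false
𝟎·y≡false []      = refl
𝟎·y≡false (c ∷ y) = 𝟎·y≡false y

translate-· : ∀ {n} (v : V₂ n) {y c} → v · y ≡ c → ∀ x → (v ⊕ x) · y ≡ c xor (x · y)
translate-· v {y} v·y x = trans (·-distribʳ-⊕ v x y) (cong (_xor (x · y)) v·y)

·≡true⇒nonzero : ∀ {n} (x y : V₂ n) → x · y ≡ true → nonzero y ≡ true
·≡true⇒nonzero []          []          ()
·≡true⇒nonzero (a ∷ x)     (true ∷ y)  _ = refl
·≡true⇒nonzero (false ∷ x) (false ∷ y) h = ·≡true⇒nonzero x y h
·≡true⇒nonzero (true ∷ x)  (false ∷ y) h = ·≡true⇒nonzero x y h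

xor≡false⇒≡ : ∀ {a b} → a xor b ≡ false → a ≡ b
xor≡false⇒≡ {false} {false} _ = refl
xor≡false⇒≡ {true}  {true}  _ = refl

𝟎∈span : ∀ {n} (L : List (V₂ n)) → InSpanList L 𝟎
𝟎∈span []      = [] , refl
𝟎∈span (v ∷ L) with c , e ← 𝟎∈span L = false ∷ c , trans (⊕-identityˡ _) e

span-there : ∀ {n} {L : List (V₂ n)} {x} v → InSpanList L x → InSpanList (v ∷ L) x
span-there v (c , e) = false ∷ c , trans (⊕-identityˡ _) e

span-here : ∀ {n} (v : V₂ n) L → InSpanList (v ∷ L) v
span-here v L with c , e ← 𝟎∈span L = true ∷ c , trans (cong (v ⊕_) e) (⊕-identityʳ v)

lincomb-⊕ : ∀ {n} (L : List (V₂ n)) c d → lincomb L c ⊕ lincomb L d ≡ lincomb L (zipWith _xor_ c d)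
lincomb-⊕ []      []       []       = ⊕-self 𝟎
lincomb-⊕ (v ∷ L) (c ∷ cs) (d ∷ ds) =
  trans (⊕-interchange (if c then v else 𝟎) (lincomb L cs) (if d then v else 𝟎) (lincomb L ds))
        (cong₂ _⊕_ (scale-⊕ c d) (lincomb-⊕ L cs ds))
  where
  scale-⊕ : ∀ c d → (if c then v else 𝟎) ⊕ (if d then v else 𝟎) ≡ (if c xor d then v else 𝟎)
  scale-⊕ true  true  = ⊕-self v
  scale-⊕ true  false = ⊕-identityʳ v
  scale-⊕ false true  = ⊕-identityˡ v
  scale-⊕ false false = ⊕-self 𝟎

span-⊕ : ∀ {n} (L : List (V₂ n)) {u w} → InSpanList L u → InSpanList L w → InSpanList L (u ⊕ w)
span-⊕ L (c , e) (d , f) = zipWith _xor_ c d , trans (sym (lincomb-⊕ L c d)) (cong₂ _⊕_ e f)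

span-lift : ∀ {n} (M : List (V₂ n)) {x} → InSpanList M x → InSpanList (map (false ∷_) M) (false ∷ x)
span-lift []      ([]     , refl) = [] , refl
span-lift (m ∷ M) (c ∷ cs , refl) with cs′ , e ← span-lift M (cs , refl) =
  c ∷ cs′ , trans (cong ((if c then false ∷ m else 𝟎) ⊕_) e) (lift-head c)
  where
  lift-head : ∀ c → (if c then false ∷ m else 𝟎) ⊕ (false ∷ lincomb M cs)
                  ≡ false ∷ ((if c then m else 𝟎) ⊕ lincomb M cs)
  lift-head true  = refl
  lift-head false = refl

_⊆span_ : ∀ {n} → List (V₂ n) → List (V₂ n) → Set
A ⊆span B = All (InSpanList B) A

_≈span_ : ∀ {n} → List (V₂ n) → List (V₂ n) → Set
A ≈span B = A ⊆span B × B ⊆span A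

IsSubspace : ∀ {n} → (V₂ n → Set) → Set
IsSubspace P = P 𝟎 × (∀ {a b} → P a → P b → P (a ⊕ b))

span-closed : ∀ {n} {P : V₂ n → Set} → IsSubspace P →
              ∀ {L} → All P L → ∀ {x} → InSpanList L x → P x
span-closed (P𝟎 , P⊕) []        ([]          , refl) = P𝟎
span-closed (P𝟎 , P⊕) (Pa ∷ PL) (true  ∷ cs , refl) = P⊕ Pa (span-closed (P𝟎 , P⊕) PL (cs , refl))
span-closed (P𝟎 , P⊕) (Pa ∷ PL) (false ∷ cs , refl) = P⊕ P𝟎 (span-closed (P𝟎 , P⊕) PL (cs , refl))

vsum-closed : ∀ {n} {P : V₂ n → Set} → IsSubspace P → ∀ {L} → All P L → P (vsum L)
vsum-closed (P𝟎 , P⊕) []        = P𝟎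
vsum-closed (P𝟎 , P⊕) (Pa ∷ PL) = P⊕ Pa (vsum-closed (P𝟎 , P⊕) PL)

span-isSubspace : ∀ {n} (L : List (V₂ n)) → IsSubspace (InSpanList L)
span-isSubspace L = 𝟎∈span L , span-⊕ L

span-mono : ∀ {n} {A B : List (V₂ n)} → A ⊆span B → ∀ {x} → InSpanList A x → InSpanList B x
span-mono {B = B} = span-closed (span-isSubspace B)

⊆span-refl : ∀ {n} (L : List (V₂ n)) → L ⊆span L
⊆span-refl []      = []
⊆span-refl (v ∷ L) = span-here v L ∷ All.map (span-there v) (⊆span-refl L)

∷-⊆span : ∀ {n} {A B : List (V₂ n)} v → A ⊆span B → (v ∷ A) ⊆span (v ∷ B)
∷-⊆span {B = B} v A⊆B = span-here v B ∷ All.map (span-there v) A⊆B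

≈span-trans : ∀ {n} {A B C : List (V₂ n)} → A ≈span B → B ≈span C → A ≈span C
≈span-trans {A = A} {C = C} (A⊆B , B⊆A) (B⊆C , C⊆B) =
  All.map (span-mono {B = C} B⊆C) A⊆B , All.map (span-mono {B = A} B⊆A) C⊆B

≈span-∷ : ∀ {n} {A B : List (V₂ n)} v → A ≈span B → (v ∷ A) ≈span (v ∷ B)
≈span-∷ v (A⊆B , B⊆A) = ∷-⊆span v A⊆B , ∷-⊆span v B⊆A

≈span-swap : ∀ {n} (a b : V₂ n) L → (a ∷ b ∷ L) ≈span (b ∷ a ∷ L)
≈span-swap a b L = swap a b , swap b a
  where
  swap : ∀ a b → (a ∷ b ∷ L) ⊆span (b ∷ a ∷ L)
  swap a b = span-there b (span-here a L) ∷ span-here b (a ∷ L)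
           ∷ All.map (span-there b ∘ span-there a) (⊆span-refl L)

≈span-add : ∀ {n} {L : List (V₂ n)} {u} v → InSpanList L u → (v ∷ L) ≈span ((v ⊕ u) ∷ L)
≈span-add {L = L} {u} v u∈L =
  subst (InSpanList ((v ⊕ u) ∷ L)) (⊕-cancelʳ v u)
        (span-⊕ _ (span-here (v ⊕ u) L) (span-there (v ⊕ u) u∈L))
    ∷ All.map (span-there (v ⊕ u)) (⊆span-refl L)
  , span-⊕ _ (span-here v L) (span-there v u∈L) ∷ All.map (span-there v) (⊆span-refl L)

_Spans_ : ∀ {n} → List (V₂ n) → (V₂ n → Set) → Set
L Spans W = ∀ y → InSpanList L y ⇔ W y

Spans-⊆span : ∀ {n} (A B : List (V₂ n)) {V W} → A Spans V → B Spans W →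
              (∀ v → V v → W v) → A ⊆span B
Spans-⊆span A B A-spans B-spans V⊆W =
  All.map (λ {v} v∈A → Equivalence.from (B-spans v) (V⊆W v (Equivalence.to (A-spans v) v∈A)))
          (⊆span-refl A)

-- Row reduction

-- Equivalent to LinIndep; this recursive form is the one row reduction consumes.
Independent : ∀ {n} → List (V₂ n) → Set
Independent []      = ⊤
Independent (v ∷ L) = ¬ InSpanList L v × Independent L

LinIndep⇒Independent : ∀ {n} (L : List (V₂ n)) → LinIndep L → Independent L
LinIndep⇒Independent []      _       = tt
LinIndep⇒Independent (v ∷ L) indep = v∉L , LinIndep⇒Independent L indepL
  where
  v∉L : ¬ InSpanList L v
  v∉L (c , e) with () ← cong V.head (indep (true ∷ c) (trans (cong (v ⊕_) e) (⊕-self v)))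
  indepL : LinIndep L
  indepL c e = cong V.tail (indep (false ∷ c) (trans (⊕-identityˡ _) e))

-- An independent list in F₂^(1+n) after eliminating the first coordinate:
-- at most one row, the pivot, starts with 1.
data Echelon (n : ℕ) : Set where
  noPivot : (M : List (V₂ n)) → Independent M → Echelon n
  pivot   : (b : V₂ n) (M : List (V₂ n)) → Independent M → Echelon n

rows : ∀ {n} → Echelon n → List (V₂ (suc n))
rows (noPivot M _) = map (false ∷_) M
rows (pivot b M _) = (true ∷ b) ∷ map (false ∷_) M

rank : ∀ {n} → Echelon n → ℕ
rank (noPivot M _) = length M
rank (pivot _ M _) = suc (length M)

RowReduction : ∀ {n} → List (V₂ (suc n)) → Set
RowReduction {n} L = Σ (Echelon n) λ E → rank E ≡ length L × L ≈span rows E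

reduce-∷ : ∀ {n} (v : V₂ (suc n)) {L} (E : Echelon n) → ¬ InSpanList (rows E) v →
           rank E ≡ length L → L ≈span rows E → RowReduction (v ∷ L)
reduce-∷ (false ∷ v) (noPivot M iM) v∉E rk L≈E =
  noPivot (v ∷ M) (v∉E ∘ span-lift M , iM) , cong suc rk , ≈span-∷ _ L≈E
reduce-∷ (true ∷ v) (noPivot M iM) v∉E rk L≈E =
  pivot v M iM , cong suc rk , ≈span-∷ _ L≈E
reduce-∷ (false ∷ v) (pivot b M iM) v∉E rk L≈E =
  pivot b (v ∷ M) (v∉E ∘ span-there _ ∘ span-lift M , iM) , cong suc rk ,
  ≈span-trans (≈span-∷ _ L≈E) (≈span-swap _ _ _)
reduce-∷ (true ∷ v) (pivot b M iM) v∉E rk L≈E =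
  pivot b ((v ⊕ b) ∷ M) (v⊕b∉M , iM) , cong suc rk ,
  ≈span-trans (≈span-∷ _ L≈E)
              (≈span-trans (≈span-add _ (span-here (true ∷ b) _)) (≈span-swap _ _ _))
  where
  b⊕[v⊕b]≡v : b ⊕ (v ⊕ b) ≡ v
  b⊕[v⊕b]≡v = trans (⊕-comm b (v ⊕ b)) (⊕-cancelʳ v b)
  v⊕b∉M : ¬ InSpanList M (v ⊕ b)
  v⊕b∉M v⊕b∈M = v∉E (subst (InSpanList _) (cong (true ∷_) b⊕[v⊕b]≡v)
                      (span-⊕ _ (span-here (true ∷ b) _) (span-there _ (span-lift M v⊕b∈M))))

reduce : ∀ {n} (L : List (V₂ (suc n))) → Independent L → RowReduction L
reduce []      _           = noPivot [] tt , refl , [] , []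
reduce (v ∷ L) (v∉L , iL) with E , rk , L≈E ← reduce L iL =
  reduce-∷ v E (v∉L ∘ span-mono {B = L} (proj₂ L≈E)) rk L≈E

-- Orthogonal complements

orth : ∀ {n} → List (V₂ n) → SubsetV n
orth L y = BL.all (λ l → not (l · y)) L

⊥-isSubspace : ∀ {n} (y : V₂ n) → IsSubspace (λ v → v · y ≡ false)
⊥-isSubspace y = 𝟎·y≡false y , λ {a} {b} a⊥y b⊥y →
  trans (·-distribʳ-⊕ a b y) (cong₂ _xor_ a⊥y b⊥y)

orth⇔All⊥ : ∀ {n} (L : List (V₂ n)) y → orth L y ≡ true ⇔ All (λ l → l · y ≡ false) L
orth⇔All⊥ L y = mk⇔
  (λ h → All.map (Equivalence.to T-not-≡) (all⁺ _ L (Equivalence.from T-≡ h)))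
  (λ h → Equivalence.to T-≡ (all⁻ _ (All.map (Equivalence.from T-not-≡) h)))

orth⇔⊥span : ∀ {n} (L : List (V₂ n)) y →
             orth L y ≡ true ⇔ (∀ {v} → InSpanList L v → v · y ≡ false)
orth⇔⊥span L y = mk⇔
  (span-closed (⊥-isSubspace y) ∘ Equivalence.to (orth⇔All⊥ L y))
  (λ h → Equivalence.from (orth⇔All⊥ L y) (All.map h (⊆span-refl L)))

orth-⊥span : ∀ {n} (L : List (V₂ n)) {y} → orth L y ≡ true →
             ∀ {v} → InSpanList L v → v · y ≡ false
orth-⊥span L {y} = Equivalence.to (orth⇔⊥span L y)

orth-cong : ∀ {n} {A B : List (V₂ n)} → A ≈span B → ∀ y → orth A y ≡ orth B y
orth-cong {A = A} {B} (A⊆B , B⊆A) y = ⇔→≡ (mk⇔ (mono B A B⊆A) (mono A B A⊆B))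
  where
  mono : ∀ C D → C ⊆span D → orth D y ≡ true → orth C y ≡ true
  mono C D C⊆D h = Equivalence.from (orth⇔⊥span C y) (orth-⊥span D h ∘ span-mono {B = D} C⊆D)

orth-lift : ∀ {n} (M : List (V₂ n)) c y → orth (map (false ∷_) M) (c ∷ y) ≡ orth M y
orth-lift []      c y = refl
orth-lift (m ∷ M) c y = cong (not (m · y) ∧_) (orth-lift M c y)

orth-witness : ∀ {n} (L : List (V₂ n)) y → orth L y ≡ false →
               Σ (V₂ n) λ v → InSpanList L v × v · y ≡ true
orth-witness (l ∷ L) y h with l · y in l·y
... | true  = l , span-here l L , l·y
... | false with v , v∈L , v·y ← orth-witness L y h = v , span-there l v∈L , v·y

orth⇔⊥ : ∀ {n} (L : List (V₂ n)) {W} → L Spans W →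
         ∀ y → orth L y ≡ true ⇔ (∀ v → W v → v · y ≡ false)
orth⇔⊥ L L-spans y = mk⇔
  (λ h v Wv → orth-⊥span L h (Equivalence.from (L-spans v) Wv))
  (λ h → Equivalence.from (orth⇔⊥span L y) (λ {v} v∈L → h v (Equivalence.to (L-spans v) v∈L)))

-- Counting subsets of F₂ⁿ

+-interchange : ∀ a b c d → (a + b) + (c + d) ≡ (a + c) + (b + d)
+-interchange = CommSemigroupProperties.interchange +-commutativeSemigroup

m+m≡2*m : ∀ m → m + m ≡ 2 * m
m+m≡2*m m = cong (_+_ m) (sym (+-identityʳ m))

∁ : ∀ {n} → SubsetV n → SubsetV n
∁ P x = not (P x)

∈allV : ∀ {n} (x : V₂ n) → x ∈ allV n
∈allV []          = here refl
∈allV (false ∷ x) = ∈-++⁺ˡ (∈-map⁺ (false ∷_) (∈allV x))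
∈allV (true ∷ x)  = ∈-++⁺ʳ (map (false ∷_) (allV _)) (∈-map⁺ (true ∷_) (∈allV x))

allB⇔ : ∀ {n} (P : SubsetV n) → allB P ≡ true ⇔ (∀ x → P x ≡ true)
allB⇔ {n} P = mk⇔
  (λ h x → Equivalence.to T-≡ (All.lookup (all⁺ P (allV n) (Equivalence.from T-≡ h)) (∈allV x)))
  (λ h → Equivalence.to T-≡ (all⁻ P {allV n} (All.tabulate (λ {x} _ → Equivalence.from T-≡ (h x)))))

#-head : ∀ {n} (P : SubsetV (suc n)) → # P ≡ # (λ x → P (false ∷ x)) + # (λ x → P (true ∷ x))
#-head {n} P = begin
  NL.sum (map χ (map (false ∷_) (allV n) ++ map (true ∷_) (allV n)))
    ≡⟨ cong NL.sum (map-++ χ (map (false ∷_) (allV n)) (map (true ∷_) (allV n))) ⟩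
  NL.sum (map χ (map (false ∷_) (allV n)) ++ map χ (map (true ∷_) (allV n)))
    ≡⟨ sum-++ (map χ (map (false ∷_) (allV n))) (map χ (map (true ∷_) (allV n))) ⟩
  NL.sum (map χ (map (false ∷_) (allV n))) + NL.sum (map χ (map (true ∷_) (allV n)))
    ≡⟨ cong₂ _+_ (cong NL.sum (map-∘ {g = χ} (allV n))) (cong NL.sum (map-∘ {g = χ} (allV n))) ⟨
  # (λ x → P (false ∷ x)) + # (λ x → P (true ∷ x)) ∎
  where
  open ≡-Reasoning
  χ : V₂ (suc n) → ℕ
  χ x = if P x then 1 else 0

#-cong : ∀ {n} {P Q : SubsetV n} → (∀ x → P x ≡ Q x) → # P ≡ # Q
#-cong {n} P≡Q = cong NL.sum (map-cong (λ x → cong (if_then 1 else 0) (P≡Q x)) (allV n))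

#-mono : ∀ {n} (P Q : SubsetV n) → (∀ x → P x ≡ true → Q x ≡ true) → # P ≤ # Q
#-mono {zero} P Q P⊆Q with P [] in P[] | Q [] in Q[]
... | false | _     = z≤n
... | true  | true  = ≤-refl
... | true  | false with () ← trans (sym Q[]) (P⊆Q [] P[])
#-mono {suc n} P Q P⊆Q rewrite #-head P | #-head Q =
  +-mono-≤ (#-mono _ _ (λ x → P⊆Q (false ∷ x))) (#-mono _ _ (λ x → P⊆Q (true ∷ x)))

#-full : ∀ n → # {n} (λ _ → true) ≡ 2 ^ n
#-full zero    = refl
#-full (suc n) =
  trans (#-head {n} (λ _ → true)) (trans (cong (λ k → k + k) (#-full n)) (m+m≡2*m (2 ^ n)))

#-split : ∀ {n} (S T : SubsetV n) → # S ≡ # (S ∩ T) + # (S ∩ ∁ T)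
#-split {zero} S T with S [] | T []
... | true  | true  = refl
... | true  | false = refl
... | false | _     = refl
#-split {suc n} S T = begin
  # S ≡⟨ #-head S ⟩
  # S₀ + # S₁ ≡⟨ cong₂ _+_ (#-split S₀ T₀) (#-split S₁ T₁) ⟩
  (# (S₀ ∩ T₀) + # (S₀ ∩ ∁ T₀)) + (# (S₁ ∩ T₁) + # (S₁ ∩ ∁ T₁))
    ≡⟨ +-interchange (# (S₀ ∩ T₀)) (# (S₀ ∩ ∁ T₀)) (# (S₁ ∩ T₁)) (# (S₁ ∩ ∁ T₁)) ⟩
  (# (S₀ ∩ T₀) + # (S₁ ∩ T₁)) + (# (S₀ ∩ ∁ T₀) + # (S₁ ∩ ∁ T₁))
    ≡⟨ cong₂ _+_ (#-head (S ∩ T)) (#-head (S ∩ ∁ T)) ⟨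
  # (S ∩ T) + # (S ∩ ∁ T) ∎
  where
  open ≡-Reasoning
  S₀ S₁ T₀ T₁ : SubsetV n
  S₀ x = S (false ∷ x)
  S₁ x = S (true ∷ x)
  T₀ x = T (false ∷ x)
  T₁ x = T (true ∷ x)

#-∁ : ∀ {n} (P : SubsetV n) → # (∁ P) ≡ 2 ^ n ∸ # P
#-∁ {n} P = sym (begin
  2 ^ n ∸ # P                 ≡⟨ cong (_∸ # P) (trans (sym (#-full n)) (#-split (λ _ → true) P)) ⟩
  # P + # (∁ P) ∸ # P         ≡⟨ m+n∸m≡n (# P) (# (∁ P)) ⟩
  # (∁ P)                     ∎)
  where open ≡-Reasoning

#-translate : ∀ {n} (v : V₂ n) (P : SubsetV n) → # (v +S P) ≡ # P
#-translate []          P = refl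
#-translate (false ∷ v) P = begin
  # ((false ∷ v) +S P)        ≡⟨ #-head ((false ∷ v) +S P) ⟩
  # (v +S P₀) + # (v +S P₁)   ≡⟨ cong₂ _+_ (#-translate v P₀) (#-translate v P₁) ⟩
  # P₀ + # P₁                 ≡⟨ #-head P ⟨
  # P                         ∎
  where
  open ≡-Reasoning
  P₀ P₁ : SubsetV _
  P₀ x = P (false ∷ x)
  P₁ x = P (true ∷ x)
#-translate (true ∷ v) P = begin
  # ((true ∷ v) +S P)         ≡⟨ #-head ((true ∷ v) +S P) ⟩
  # (v +S P₁) + # (v +S P₀)   ≡⟨ cong₂ _+_ (#-translate v P₁) (#-translate v P₀) ⟩
  # P₁ + # P₀                 ≡⟨ +-comm (# P₁) (# P₀) ⟩
  # P₀ + # P₁                 ≡⟨ #-head P ⟨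
  # P                         ∎
  where
  open ≡-Reasoning
  P₀ P₁ : SubsetV _
  P₀ x = P (false ∷ x)
  P₁ x = P (true ∷ x)

-- Dimension counts

length≤dim : ∀ {n} (L : List (V₂ n)) → Independent L → length L ≤ n
length≤dim {zero}  []       _          = z≤n
length≤dim {zero}  ([] ∷ L) (𝟎∉L , _) = ⊥-elim (𝟎∉L (𝟎∈span L))
length≤dim {suc n} L        iL with reduce L iL
... | noPivot M iM , rk , _ = subst (_≤ suc n) rk (m≤n⇒m≤1+n (length≤dim M iM))
... | pivot _ M iM , rk , _ = subst (_≤ suc n) rk (s≤s (length≤dim M iM))

#orth      : ∀ {n} (L : List (V₂ n)) → Independent L → # (orth L) ≡ 2 ^ (n ∸ length L)
#orth-rows : ∀ {n} (E : Echelon n) → # (orth (rows E)) ≡ 2 ^ (suc n ∸ rank E)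

#orth {zero}  []       _          = refl
#orth {zero}  ([] ∷ L) (𝟎∉L , _) = ⊥-elim (𝟎∉L (𝟎∈span L))
#orth {suc n} L        iL with E , rk , L≈E ← reduce L iL = begin
  # (orth L)             ≡⟨ #-cong (orth-cong L≈E) ⟩
  # (orth (rows E))      ≡⟨ #orth-rows E ⟩
  2 ^ (suc n ∸ rank E)   ≡⟨ cong (λ k → 2 ^ (suc n ∸ k)) rk ⟩
  2 ^ (suc n ∸ length L) ∎
  where open ≡-Reasoning

#orth-rows {n} (noPivot M iM) = begin
  # (orth (map (false ∷_) M))
    ≡⟨ #-head (orth (map (false ∷_) M)) ⟩
  # (λ y → orth (map (false ∷_) M) (false ∷ y)) + # (λ y → orth (map (false ∷_) M) (true ∷ y))
    ≡⟨ cong₂ _+_ (#-cong (orth-lift M false)) (#-cong (orth-lift M true)) ⟩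
  # (orth M) + # (orth M)
    ≡⟨ cong (λ k → k + k) (#orth M iM) ⟩
  2 ^ (n ∸ length M) + 2 ^ (n ∸ length M)
    ≡⟨ m+m≡2*m (2 ^ (n ∸ length M)) ⟩
  2 ^ suc (n ∸ length M)
    ≡⟨ cong (2 ^_) (+-∸-assoc 1 (length≤dim M iM)) ⟨
  2 ^ (suc n ∸ length M) ∎
  where open ≡-Reasoning
#orth-rows {n} (pivot b M iM) = begin
  # (orth ((true ∷ b) ∷ map (false ∷_) M))
    ≡⟨ #-head (orth ((true ∷ b) ∷ map (false ∷_) M)) ⟩
  # (λ y → b⊥ y ∧ orth (map (false ∷_) M) (false ∷ y))
    + # (λ y → ∁ b⊥ y ∧ orth (map (false ∷_) M) (true ∷ y))
    ≡⟨ cong₂ _+_ (#-cong (λ y → trans (cong (b⊥ y ∧_) (orth-lift M false y)) (∧-comm (b⊥ y) _)))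
                 (#-cong (λ y → trans (cong (∁ b⊥ y ∧_) (orth-lift M true y)) (∧-comm (∁ b⊥ y) _))) ⟩
  # (orth M ∩ b⊥) + # (orth M ∩ ∁ b⊥)
    ≡⟨ #-split (orth M) b⊥ ⟨
  # (orth M)
    ≡⟨ #orth M iM ⟩
  2 ^ (n ∸ length M) ∎
  where
  open ≡-Reasoning
  b⊥ : SubsetV n
  b⊥ y = not (b · y)

periods⇒2^length∣#    : ∀ {n} (L : List (V₂ n)) → Independent L → (P : SubsetV n) →
                          (∀ {v} → InSpanList L v → InF P v) → 2 ^ length L ∣ # P
periods⇒2^rank∣#-rows : ∀ {n} (E : Echelon n) (P : SubsetV (suc n)) →
                          (∀ {v} → InSpanList (rows E) v → InF P v) → 2 ^ rank E ∣ # P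

periods⇒2^length∣# {zero}  []       _          P _ = 1∣ # P
periods⇒2^length∣# {zero}  ([] ∷ L) (𝟎∉L , _) _ _ = ⊥-elim (𝟎∉L (𝟎∈span L))
periods⇒2^length∣# {suc n} L        iL         P periodic with E , rk , (_ , E⊆L) ← reduce L iL =
  subst (λ k → 2 ^ k ∣ # P) rk (periods⇒2^rank∣#-rows E P (periodic ∘ span-mono {B = L} E⊆L))

periods⇒2^rank∣#-rows (noPivot M iM) P periodic = subst (2 ^ length M ∣_) (sym (#-head P))
  (∣m∣n⇒∣m+n (periods⇒2^length∣# M iM _ (λ v∈M x → periodic (span-lift M v∈M) (false ∷ x)))
             (periods⇒2^length∣# M iM _ (λ v∈M x → periodic (span-lift M v∈M) (true ∷ x))))
periods⇒2^rank∣#-rows {n} (pivot b M iM) P periodic =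
  subst (2 ^ suc (length M) ∣_) (sym #P≡2*#P₀)
    (*-monoʳ-∣ 2 (periods⇒2^length∣# M iM P₀ λ v∈M x →
                    periodic (span-there _ (span-lift M v∈M)) (false ∷ x)))
  where
  open ≡-Reasoning
  P₀ : SubsetV n
  P₀ x = P (false ∷ x)
  P₁≡b+P₀ : ∀ x → P (true ∷ x) ≡ (b +S P₀) x
  P₁≡b+P₀ x = trans (cong (λ z → P (true ∷ z)) (sym (⊕-cancelˡ b x)))
                    (periodic (span-here (true ∷ b) _) (false ∷ (b ⊕ x)))
  #P≡2*#P₀ : # P ≡ 2 * # P₀
  #P≡2*#P₀ = begin
    # P                               ≡⟨ #-head P ⟩
    # P₀ + # (λ x → P (true ∷ x))     ≡⟨ cong (_+_ (# P₀)) (#-cong P₁≡b+P₀) ⟩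
    # P₀ + # (b +S P₀)                ≡⟨ cong (_+_ (# P₀)) (#-translate b P₀) ⟩
    # P₀ + # P₀                       ≡⟨ m+m≡2*m (# P₀) ⟩
    2 * # P₀                          ∎

2^-cancel-≤ : ∀ {a b} → 2 ^ a ≤ 2 ^ b → a ≤ b
2^-cancel-≤ 2^a≤2^b = ≮⇒≥ (λ b<a → <⇒≱ (^-monoʳ-< 2 (s≤s (s≤s z≤n)) b<a) 2^a≤2^b)

⊆span⇒length≤ : ∀ {n} (A B : List (V₂ n)) → Independent A → Independent B →
                A ⊆span B → length A ≤ length B
⊆span⇒length≤ {n} A B iA iB A⊆B =
  subst₂ _≤_ (m∸[m∸n]≡n (length≤dim A iA)) (m∸[m∸n]≡n (length≤dim B iB)) (∸-monoʳ-≤ n codim≤)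
  where
  orthB⊆orthA : ∀ y → orth B y ≡ true → orth A y ≡ true
  orthB⊆orthA y h = Equivalence.from (orth⇔⊥span A y) (orth-⊥span B h ∘ span-mono {B = B} A⊆B)
  codim≤ : n ∸ length B ≤ n ∸ length A
  codim≤ = 2^-cancel-≤ (subst₂ _≤_ (#orth B iB) (#orth A iA) (#-mono (orth B) (orth A) orthB⊆orthA))

-- Balanced and constant directions

InF-∩ : ∀ {n} {P Q : SubsetV n} {v} → InF P v → InF Q v → InF (P ∩ Q) v
InF-∩ P-periodic Q-periodic z = cong₂ _∧_ (P-periodic z) (Q-periodic z)

InF-H : ∀ {n} (v : V₂ n) {y} → v · y ≡ false → InF H[ y ] v
InF-H v v⊥y z = cong not (translate-· v v⊥y z)

balanced⇔ : ∀ {n} (S : SubsetV n) y → balanced S y ≡ true ⇔ 2 * # (S ∩ H[ y ]) ≡ # S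
balanced⇔ S y = mk⇔ (≡ᵇ⇒≡ _ _ ∘ Equivalence.from T-≡) (Equivalence.to T-≡ ∘ ≡⇒≡ᵇ _ _)

balanced-by-period : ∀ {n} (S : SubsetV n) {v y} → InF S v → v · y ≡ true → 2 * # (S ∩ H[ y ]) ≡ # S
balanced-by-period S {v} {y} v-period v·y = sym (begin
  # S                                   ≡⟨ #-split S H[ y ] ⟩
  # (S ∩ H[ y ]) + # (S ∩ ∁ H[ y ])     ≡⟨ cong (_+_ (# (S ∩ H[ y ]))) (#-cong swap) ⟩
  # (S ∩ H[ y ]) + # (v +S (S ∩ H[ y ])) ≡⟨ cong (_+_ (# (S ∩ H[ y ]))) (#-translate v (S ∩ H[ y ])) ⟩
  # (S ∩ H[ y ]) + # (S ∩ H[ y ])       ≡⟨ m+m≡2*m (# (S ∩ H[ y ])) ⟩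
  2 * # (S ∩ H[ y ])                    ∎)
  where
  open ≡-Reasoning
  swap : ∀ x → (S ∩ ∁ H[ y ]) x ≡ (v +S (S ∩ H[ y ])) x
  swap x = cong₂ _∧_ (sym (v-period x)) (cong not (sym (translate-· v v·y x)))

balanced⇒2^[1+length]∣# : ∀ {n} (S : SubsetV n) L {y} → Independent L →
                          (∀ {v} → InSpanList L v → InF S v) → orth L y ≡ true →
                          2 * # (S ∩ H[ y ]) ≡ # S → 2 ^ suc (length L) ∣ # S
balanced⇒2^[1+length]∣# S L {y} iL L⊆F y⊥L bal = subst (2 ^ suc (length L) ∣_) bal (*-monoʳ-∣ 2
  (periods⇒2^length∣# L iL (S ∩ H[ y ]) λ {v} v∈L →
     InF-∩ (L⊆F v∈L) (InF-H v (orth-⊥span L y⊥L v∈L))))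

InH⇔orth : ∀ {n} {S : SubsetV n} L → L Spans InF S → ∀ y → InH S y ⇔ orth L y ≡ true
InH⇔orth L L-spans-F y = mk⇔
  (λ y∈H → Equivalence.from (orth⇔⊥ L L-spans-F y) (λ s s∈F → not-injective (y∈H s s∈F)))
  (λ y⊥L s s∈F → cong not (Equivalence.to (orth⇔⊥ L L-spans-F y) y⊥L s s∈F))

module _ {n} {S : SubsetV n} {L : List (V₂ n)} (L-spans-F : L Spans InF S) (iL : Independent L)
         (∤#S : ¬ (2 ^ suc (length L) ∣ # S)) where

  Bset≡∁orth : ∀ y → Bset S y ≡ not (orth L y)
  Bset≡∁orth y with orth L y in y⊥L
  ... | true  = ¬-not λ y∈B → ∤#S (balanced⇒2^[1+length]∣# S L iL (Equivalence.to (L-spans-F _)) y⊥L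
                                     (Equivalence.to (balanced⇔ S y) (∧-conicalʳ _ _ y∈B)))
  ... | false with v , v∈L , v·y ← orth-witness L y y⊥L =
    cong₂ _∧_ (·≡true⇒nonzero v y v·y)
              (Equivalence.from (balanced⇔ S y) (balanced-by-period S (Equivalence.to (L-spans-F v) v∈L) v·y))

  Bset⇔¬InH : ∀ y → Bset S y ≡ true ⇔ (¬ InH S y)
  Bset⇔¬InH y = mk⇔
    (λ y∈B y∈H → case trans (sym y∈B) (trans (Bset≡∁orth y) (cong not (InH⇒orth y∈H))) of λ ())
    (λ y∉H → trans (Bset≡∁orth y) (cong not (¬-not (y∉H ∘ orth⇒InH))))
    where
    InH⇒orth : InH S y → orth L y ≡ true
    InH⇒orth = Equivalence.to (InH⇔orth L L-spans-F y)
    orth⇒InH : orth L y ≡ true → InH S y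
    orth⇒InH = Equivalence.from (InH⇔orth L L-spans-F y)

  #Bset : # (Bset S) ≡ 2 ^ n ∸ 2 ^ (n ∸ length L)
  #Bset = begin
    # (Bset S)                 ≡⟨ #-cong Bset≡∁orth ⟩
    # (∁ (orth L))             ≡⟨ #-∁ (orth L) ⟩
    2 ^ n ∸ # (orth L)         ≡⟨ cong (2 ^ n ∸_) (#orth L iL) ⟩
    2 ^ n ∸ 2 ^ (n ∸ length L) ∎
    where open ≡-Reasoning

ConstantPairing : ∀ {n} → SubsetV n → V₂ n → Set
ConstantPairing S y = Σ Bool λ c → ∀ z → S z ≡ true → z · y ≡ c

yconstant⇔ : ∀ {n} (S : SubsetV n) y → yconstant S y ≡ true ⇔ ConstantPairing S y
yconstant⇔ {n} S y = mk⇔ to from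
  where
  S⊆H S∩H=∅ : SubsetV n
  S⊆H x = not (S x) ∨ H[ y ] x
  S∩H=∅ x = not (S x ∧ H[ y ] x)
  to : yconstant S y ≡ true → ConstantPairing S y
  to h with allB S⊆H in S⊆H-holds
  ... | true  = false , λ z z∈S → not-injective
                  (subst (λ b → not b ∨ H[ y ] z ≡ true) z∈S (Equivalence.to (allB⇔ S⊆H) S⊆H-holds z))
  ... | false = true , λ z z∈S → not-injective (not-injective
                  (subst (λ b → not (b ∧ H[ y ] z) ≡ true) z∈S (Equivalence.to (allB⇔ S∩H=∅) h z)))
  from : ConstantPairing S y → yconstant S y ≡ true
  from (false , S⊥y) = cong (_∨ allB S∩H=∅) (Equivalence.from (allB⇔ S⊆H) inside)
    where
    inside : ∀ x → S⊆H x ≡ true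
    inside x with S x in x∈S
    ... | false = refl
    ... | true  = cong not (S⊥y x x∈S)
  from (true , S·y≡1) =
    trans (cong (allB S⊆H ∨_) (Equivalence.from (allB⇔ S∩H=∅) outside)) (∨-zeroʳ (allB S⊆H))
    where
    outside : ∀ x → S∩H=∅ x ≡ true
    outside x with S x in x∈S
    ... | false = refl
    ... | true  = cong (not ∘ not) (S·y≡1 x x∈S)

constant⇔translate⊥ : ∀ {n} {S : SubsetV n} {s₀} → S s₀ ≡ true → ∀ y →
  ConstantPairing S y ⇔ (∀ t → (s₀ +S S) t ≡ true → t · y ≡ false)
constant⇔translate⊥ {S = S} {s₀} s₀∈S y = mk⇔
  (λ (c , S·y≡c) t t∈s₀+S → begin
    t · y                          ≡⟨ cong (_· y) (⊕-cancelˡ s₀ t) ⟨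
    (s₀ ⊕ (s₀ ⊕ t)) · y            ≡⟨ ·-distribʳ-⊕ s₀ (s₀ ⊕ t) y ⟩
    (s₀ · y) xor ((s₀ ⊕ t) · y)    ≡⟨ cong₂ _xor_ (S·y≡c s₀ s₀∈S) (S·y≡c (s₀ ⊕ t) t∈s₀+S) ⟩
    c xor c                        ≡⟨ xor-same c ⟩
    false                          ∎)
  (λ s₀+S⊥y → s₀ · y , λ z z∈S → sym (xor≡false⇒≡
    (trans (sym (·-distribʳ-⊕ s₀ z y))
           (s₀+S⊥y (s₀ ⊕ z) (trans (cong S (⊕-cancelˡ s₀ z)) z∈S)))))
  where open ≡-Reasoning

⊥generators⇔⊥InSpan : ∀ {n} (T : V₂ n → Set) y →
                      (∀ t → T t → t · y ≡ false) ⇔ (∀ v → InSpan T v → v · y ≡ false)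
⊥generators⇔⊥InSpan T y = mk⇔
  (λ T⊥y v (L , L⊆T , vsum≡v) →
     subst (λ v → v · y ≡ false) vsum≡v (vsum-closed (⊥-isSubspace y) (All.map (T⊥y _) L⊆T)))
  (λ span⊥y t t∈T → span⊥y t (t ∷ [] , t∈T ∷ [] , ⊕-identityʳ t))

Cset≡orth : ∀ {n} {S : SubsetV n} {s₀} → S s₀ ≡ true →
            ∀ L → L Spans InSpan (λ t → (s₀ +S S) t ≡ true) → ∀ y → Cset S y ≡ orth L y
Cset≡orth {S = S} {s₀} s₀∈S L L-spans y = ⇔→≡ (begin
  Cset S y ≡ true                                       ≈⟨ yconstant⇔ S y ⟩
  ConstantPairing S y                                   ≈⟨ constant⇔translate⊥ s₀∈S y ⟩
  (∀ t → (s₀ +S S) t ≡ true → t · y ≡ false)            ≈⟨ ⊥generators⇔⊥InSpan _ y ⟩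
  (∀ v → InSpan (λ t → (s₀ +S S) t ≡ true) v → v · y ≡ false) ≈⟨ orth⇔⊥ L L-spans y ⟨
  orth L y ≡ true                                       ∎)
  where open SetoidReasoning (⇔-setoid 0ℓ)

-- The balancing number

divℕ-*-cancelʳ : ∀ q d .{{_ : NonZero d}} → divℕ (q * d) d ≡ (+ q) / 1
divℕ-*-cancelʳ q (suc d) =
  fromℚᵘ-cong {mkℚᵘ (+ (q * suc d)) d} {mkℚᵘ (+ q) 0}
    (*≡* (trans (ℤ.*-identityʳ _) (ℤ.pos-* q (suc d))))

2^n∸2^[n∸f] : ∀ {f r n} → f ≤ r → r ≤ n →
              2 ^ n ∸ 2 ^ (n ∸ f) ≡ 2 ^ (r ∸ f) * (2 ^ f ∸ 1) * 2 ^ (n ∸ r)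
2^n∸2^[n∸f] {f} {r} {n} f≤r r≤n = begin
  2 ^ n ∸ 2 ^ (n ∸ f)
    ≡⟨ cong (λ k → 2 ^ k ∸ 2 ^ (n ∸ f)) (m+[n∸m]≡n (≤-trans f≤r r≤n)) ⟨
  2 ^ (f + (n ∸ f)) ∸ 2 ^ (n ∸ f)
    ≡⟨ cong₂ _∸_ (^-distribˡ-+-* 2 f (n ∸ f)) (sym (*-identityˡ (2 ^ (n ∸ f)))) ⟩
  2 ^ f * 2 ^ (n ∸ f) ∸ 1 * 2 ^ (n ∸ f)
    ≡⟨ *-distribʳ-∸ (2 ^ (n ∸ f)) (2 ^ f) 1 ⟨
  (2 ^ f ∸ 1) * 2 ^ (n ∸ f)
    ≡⟨ cong (λ k → (2 ^ f ∸ 1) * 2 ^ k) n∸f≡r∸f+n∸r ⟩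
  (2 ^ f ∸ 1) * 2 ^ ((r ∸ f) + (n ∸ r))
    ≡⟨ cong ((2 ^ f ∸ 1) *_) (^-distribˡ-+-* 2 (r ∸ f) (n ∸ r)) ⟩
  (2 ^ f ∸ 1) * (2 ^ (r ∸ f) * 2 ^ (n ∸ r))
    ≡⟨ *-assoc (2 ^ f ∸ 1) (2 ^ (r ∸ f)) (2 ^ (n ∸ r)) ⟨
  (2 ^ f ∸ 1) * 2 ^ (r ∸ f) * 2 ^ (n ∸ r)
    ≡⟨ cong (_* 2 ^ (n ∸ r)) (*-comm (2 ^ f ∸ 1) (2 ^ (r ∸ f))) ⟩
  2 ^ (r ∸ f) * (2 ^ f ∸ 1) * 2 ^ (n ∸ r) ∎
  where
  open ≡-Reasoning
  n∸f≡r∸f+n∸r : n ∸ f ≡ (r ∸ f) + (n ∸ r)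
  n∸f≡r∸f+n∸r = begin
    n ∸ f                         ≡⟨ cong (_∸ f) (m+[n∸m]≡n r≤n) ⟨
    r + (n ∸ r) ∸ f               ≡⟨ cong (λ k → k + (n ∸ r) ∸ f) (m+[n∸m]≡n f≤r) ⟨
    (f + (r ∸ f)) + (n ∸ r) ∸ f   ≡⟨ cong (_∸ f) (+-assoc f (r ∸ f) (n ∸ r)) ⟩
    f + ((r ∸ f) + (n ∸ r)) ∸ f   ≡⟨ m+n∸m≡n f ((r ∸ f) + (n ∸ r)) ⟩
    (r ∸ f) + (n ∸ r)             ∎

#Cset : ∀ {n} {S : SubsetV n} {s₀} → S s₀ ≡ true → ∀ L → Independent L →
        L Spans InSpan (λ t → (s₀ +S S) t ≡ true) → # (Cset S) ≡ 2 ^ (n ∸ length L)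
#Cset s₀∈S L iL L-spans = trans (#-cong (Cset≡orth s₀∈S L L-spans)) (#orth L iL)

period∈translate : ∀ {n} {S : SubsetV n} {s₀ v} → S s₀ ≡ true → InF S v → (s₀ +S S) v ≡ true
period∈translate {S = S} {s₀} {v} s₀∈S v∈F = trans (cong S (⊕-comm s₀ v)) (trans (v∈F s₀) s₀∈S)

proposition9 : (n : ℕ) (S : SubsetV n) (f r : ℕ) (s₀ : V₂ n) → S s₀ ≡ true
    → HasDim (InF S) f
    → HasDim (InSpan (λ x → (s₀ +S S) x ≡ true)) r
    → ¬ ((2 ^ suc f) ∣ # S)
    → (∀ y → (Bset S y ≡ true) ⇔ (¬ InH S y))
    × (bnum S ≡ (+ (2 ^ (r ∸ f) * (2 ^ f ∸ 1))) / 1)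
proposition9 n S _ _ s₀ s₀∈S (LF , refl , indF , LF-spans) (LW , refl , indW , LW-spans) ∤#S =
  Bset⇔¬InH LF-spans iF ∤#S , (begin
    bnum S
      ≡⟨ cong₂ divℕ (#Bset LF-spans iF ∤#S) (#Cset s₀∈S LW iW LW-spans) ⟩
    divℕ (2 ^ n ∸ 2 ^ (n ∸ f)) (2 ^ (n ∸ r))
      ≡⟨ cong (λ k → divℕ k (2 ^ (n ∸ r))) (2^n∸2^[n∸f] f≤r (length≤dim LW iW)) ⟩
    divℕ (2 ^ (r ∸ f) * (2 ^ f ∸ 1) * 2 ^ (n ∸ r)) (2 ^ (n ∸ r))
      ≡⟨ divℕ-*-cancelʳ (2 ^ (r ∸ f) * (2 ^ f ∸ 1)) (2 ^ (n ∸ r)) {{m^n≢0 2 (n ∸ r)}} ⟩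
    (+ (2 ^ (r ∸ f) * (2 ^ f ∸ 1))) / 1 ∎)
  where
  open ≡-Reasoning
  f r : ℕ
  f = length LF
  r = length LW
  iF : Independent LF
  iF = LinIndep⇒Independent LF indF
  iW : Independent LW
  iW = LinIndep⇒Independent LW indW
  f≤r : f ≤ r
  f≤r = ⊆span⇒length≤ LF LW iF iW (Spans-⊆span LF LW LF-spans LW-spans λ v v∈F →
          v ∷ [] , period∈translate s₀∈S v∈F ∷ [] , ⊕-identityʳ v)
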